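{- Let $\alpha=(a_1,\dots,a_n)\in PP_n$ and $\rho=(r_1,\dots,r_n)\in\{0,1\}^n$. Then $(\alpha,\rho)\in PR_n$ if and only if for every maximal interval $[p,q]\subseteq U_\alpha$ there exist an integer $m\ge q-p+2$ and indices $j_1<j_2<\dots<j_m$ in $[n]$ such that $a_{j_1}=a_{j_2}$ and, for all $i=2,\dots,m$, $a_{j_i}=m-i+p$ and $r_{j_i}=1$.
   Context: $[n]=\{1,\dots,n\}$, $[a,b]$ the integer interval, $PP_n=[n]^n$. $|\alpha|_i=|\{j:a_j=i\}|$, $u_\alpha(j)=\sum_{i=j}^n|\alpha|_i-(n-j+1)$, $U_\alpha=\{j\in[n]:u_\alpha(j)\ge1\}$. A maximal interval of a finite set $A\subseteq\mathbb N$ is an interval in $A$ not strictly contained in another interval in $A$. A car with preference $a$ following the standard ($0$-Naples) rule parks at $a$ if free, else at the first free spot $>a$, failing if none; following the $1$-Naples rule it parks at $a$ if free, else at $a-1$ if $a\ge2$ and $a-1$ is free, else at the first free spot $>a$, failing if none. Given $\rho\in\{0,1\}^n$, cars $c_1,\dots,c_n$ arrive in order at a street with spots $1,\dots,n$, car $c_i$ having preference $a_i$ and following the $r_i$-Naples rule; $PR_n$ is the set of pairs $(\alpha,\rho)$ for which all cars park. -}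

module Defs where

open import Data.Nat using (ℕ; zero; suc; _+_; _∸_; _≤_; _<_; _≡ᵇ_; _≤ᵇ_)
open import Data.Nat.Properties using (_≟_)
open import Data.Bool using (Bool; true; false; if_then_else_; _∧_; not)
open import Data.List using (List; []; _∷_; filter; length; map)
open import Data.Bool.ListAction using (any)
open import Data.Nat.ListAction using (sum)
open import Data.Maybe using (Maybe; just; nothing; is-just)
open import Data.Vec using (Vec; toList; lookup)
open import Data.Fin using (Fin; toℕ)
open import Data.Product using (_×_; Σ)
open import Data.Integer using (ℤ; +_; _-_; _≥_)
open import Relation.Binary.PropositionalEquality using (_≡_)

InPP : (n : ℕ) → Vec ℕ n → Set
InPP n α = (i : Fin n) → 1 ≤ lookup α i × lookup α i ≤ n

-- Parking process.  A street state is the list of occupied spots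
-- (spots are 1..n).

occupied : List ℕ → ℕ → Bool
occupied occ x = any (λ y → y ≡ᵇ x) occ

freeSpot : ℕ → List ℕ → ℕ → Bool
freeSpot n occ x = (1 ≤ᵇ x) ∧ (x ≤ᵇ n) ∧ not (occupied occ x)

firstFreeFrom : ℕ → List ℕ → ℕ → ℕ → Maybe ℕ
firstFreeFrom n occ b zero = nothing
firstFreeFrom n occ b (suc k) =
  if freeSpot n occ b then just b else firstFreeFrom n occ (suc b) k

-- r-Naples rule for r ∈ {0,1} (false = 0, true = 1): spot where a car
-- with preference a parks, or nothing if it fails.
parkSpot : ℕ → List ℕ → ℕ → Bool → Maybe ℕ
parkSpot n occ a r =
  if freeSpot n occ a then just a
  else (if r ∧ (2 ≤ᵇ a) ∧ freeSpot n occ (a ∸ 1) then just (a ∸ 1)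
        else firstFreeFrom n occ (suc a) n)

runCars : ℕ → List ℕ → List ℕ → List Bool → Maybe (List ℕ)
runCars n occ [] _ = just occ
runCars n occ (a ∷ as) [] = nothing
runCars n occ (a ∷ as) (r ∷ rs) with parkSpot n occ a r
... | nothing = nothing
... | just s = runCars n (s ∷ occ) as rs

InPR : (n : ℕ) → Vec ℕ n → Vec Bool n → Set
InPR n α ρ = is-just (runCars n [] (toList α) (toList ρ)) ≡ true

count : {n : ℕ} → Vec ℕ n → ℕ → ℕ
count α i = length (filter (λ a → a ≟ i) (toList α))

range : ℕ → ℕ → List ℕ
range j n = go j (suc n ∸ j)
  where
  go : ℕ → ℕ → List ℕ
  go x zero = []
  go x (suc k) = x ∷ go (suc x) k

u : (n : ℕ) → Vec ℕ n → ℕ → ℤ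
u n α j = + sum (map (count α) (range j n)) - + (n ∸ j + 1)

InU : (n : ℕ) → Vec ℕ n → ℕ → Set
InU n α j = (1 ≤ j × j ≤ n) × u n α j ≥ + 1

IsIntervalIn : (ℕ → Set) → ℕ → ℕ → Set
IsIntervalIn A p q = p ≤ q × ((j : ℕ) → p ≤ j → j ≤ q → A j)

IsMaximalInterval : (ℕ → Set) → ℕ → ℕ → Set
IsMaximalInterval A p q =
  IsIntervalIn A p q ×
  ((p' q' : ℕ) → IsIntervalIn A p' q' → p' ≤ p → q ≤ q' → p' ≡ p × q' ≡ q)

-- A spot j is crowded (j ∈ U_α) when more cars prefer a spot ≥ j than there are spots ≥ j.
-- If every car parks, some car preferring a crowded j must step back to j - 1; the spot j it
-- found taken was taken by an earlier car that either preferred j or itself stepped back from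
-- j + 1.  Following these back-steps yields the chain of the theorem, and it reaches the right
-- end q of the interval because no car can step back onto the spot of the chain's head.
-- Conversely, if car t fails, let [j, n] be the block of taken spots that stopped it, so that
-- j - 1 is free; counting shows that j is crowded.  In the chain of the maximal crowded
-- interval around j, the car b preferring j cannot be t (t would have stepped back), cannot
-- come after t (then p - 1 would be crowded as well, by counting), and cannot come before t:
-- then every later link finds its preferred spot free, so the head's spot is free when the
-- last link arrives, although the head parked there earlier.
module Submission where

open import Data.Bool using (Bool; true; false; _∧_; if_then_else_)
open import Data.Bool.Properties using (T-≡; ¬-not; ∨-zeroʳ; ∧-conicalˡ; ∧-conicalʳ)
open import Data.Empty using (⊥; ⊥-elim)
open import Data.Fin as F using (Fin; toℕ; fromℕ<; zero; suc)
open import Data.Fin.Properties using (toℕ-fromℕ<; toℕ<n)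
import Data.Integer as ℤ
import Data.Integer.Properties as ℤ
open import Data.List using (List; []; _∷_; length; filter; map; applyUpTo; upTo)
open import Data.List.Membership.Propositional using (_∈_; find; lose)
open import Data.List.Membership.Propositional.Properties
  using (∈-filter⁺; ∈-filter⁻; ∈-applyUpTo⁺; ∈-applyUpTo⁻; ∈-upTo⁺; ∈-upTo⁻; ∈-map⁺; ∈-map⁻)
open import Data.List.Properties
  using ( length-applyUpTo; length-map; length-filter; map-upTo
        ; filter-accept; filter-reject; filter-none)
open import Data.List.Relation.Binary.Subset.Propositional using (_⊆_)
import Data.List.Relation.Unary.All as All
import Data.List.Relation.Unary.All.Properties as All
open import Data.List.Relation.Unary.AllPairs using ([]; _∷_)
open import Data.List.Relation.Unary.Any using (here; there; any?)
open import Data.List.Relation.Unary.Unique.Propositional using (Unique)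
import Data.List.Relation.Unary.Unique.Propositional.Properties as Unique
open import Data.Maybe using (Maybe; just; nothing; maybe′; is-just; fromMaybe)
open import Data.Maybe.Properties using (≡-dec)
open import Data.Nat using (ℕ; zero; suc; _+_; _∸_; _≤_; _<_; _≰_; z≤n; s≤s; z<s; s≤s⁻¹; _≤?_; _<?_; _≤ᵇ_; _≡ᵇ_)
open import Data.Nat.Induction using (<-wellFounded)
open import Data.Nat.ListAction using (sum)
open import Data.Nat.Properties
open import Data.Product using (_×_; _,_; Σ; ∃; ∃-syntax; proj₁; proj₂)
open import Data.Sum using (_⊎_; inj₁; inj₂)
open import Data.Vec using (Vec; _∷_; toList; lookup)
open import Data.Vec.Properties using (length-toList)
open import Function using (_∘_; _⇔_; mk⇔; case_of_; Equivalence)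
import Function.Properties.Equivalence as ⇔
open import Induction.WellFounded using (Acc; acc)
open import Relation.Binary.Definitions using (DecidableEquality; tri<; tri≈; tri>)
open import Relation.Binary.PropositionalEquality
open import Relation.Nullary using (¬_; Dec; yes; no; does)
open import Relation.Nullary.Decidable using (_×-dec_; dec-true; dec-false)
open import Relation.Nullary.Negation using (contradiction)
open import Relation.Unary using (Decidable)

open import Defs

at : {A : Set} → A → List A → ℕ → A
at d []       i       = d
at d (x ∷ xs) zero    = x
at d (x ∷ xs) (suc i) = at d xs i

applyUpTo-at : {A : Set} (d : A) (xs : List A) → applyUpTo (at d xs) (length xs) ≡ xs
applyUpTo-at d []       = refl
applyUpTo-at d (x ∷ xs) = cong (x ∷_) (applyUpTo-at d xs)

lookup≡at : {A : Set} {n : ℕ} (d : A) (v : Vec A n) (i : Fin n) → lookup v i ≡ at d (toList v) (toℕ i)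
lookup≡at d (x ∷ v) zero    = refl
lookup≡at d (x ∷ v) (suc i) = lookup≡at d v i

at-shift : ∀ {B : Set} (f : ℕ → B) {b : B} {t y ys} → (∀ i → at b (y ∷ ys) i ≡ f (i + t)) →
  ∀ i → at b ys i ≡ f (i + suc t)
at-shift f {t = t} h i = trans (h (suc i)) (cong f (sym (+-suc i t)))

applyUpTo-cong : {A : Set} {f g : ℕ → A} → (∀ i → f i ≡ g i) → ∀ k → applyUpTo f k ≡ applyUpTo g k
applyUpTo-cong f≗g zero    = refl
applyUpTo-cong f≗g (suc k) = cong₂ _∷_ (f≗g 0) (applyUpTo-cong (f≗g ∘ suc) k)

module _ {A : Set} (_≟_ : DecidableEquality A) where

  remove : A → List A → List A
  remove x []       = []
  remove x (y ∷ ys) with x ≟ y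
  ... | yes _ = ys
  ... | no  _ = y ∷ remove x ys

  length-remove : ∀ {x ys} → x ∈ ys → length ys ≡ suc (length (remove x ys))
  length-remove {x} {y ∷ ys} x∈ with x ≟ y | x∈
  ... | yes _  | _          = refl
  ... | no x≢y | here x≡y   = contradiction x≡y x≢y
  ... | no _   | there x∈ys = cong suc (length-remove x∈ys)

  ∈-remove : ∀ {x z ys} → z ∈ ys → z ≢ x → z ∈ remove x ys
  ∈-remove {x} {z} {y ∷ ys} z∈ z≢x with x ≟ y | z∈
  ... | yes refl | here z≡x   = contradiction z≡x z≢x
  ... | yes refl | there z∈ys = z∈ys
  ... | no _     | here z≡y   = here z≡y
  ... | no _     | there z∈ys = there (∈-remove z∈ys z≢x)

  Unique-⊆⇒length≤ : ∀ {xs ys} → Unique xs → xs ⊆ ys → length xs ≤ length ys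
  Unique-⊆⇒length≤ {[]}     _              _  = z≤n
  Unique-⊆⇒length≤ {x ∷ xs} {ys} (x∉ ∷ uxs) xs⊆ys rewrite length-remove (xs⊆ys (here refl)) =
    s≤s (Unique-⊆⇒length≤ uxs λ z∈xs → ∈-remove (xs⊆ys (there z∈xs)) (λ { refl → All.lookup x∉ z∈xs refl }))

Unique-map⁺ : {A B : Set} (f : A → B) {xs : List A} → Unique xs →
  (∀ {x y} → x ∈ xs → y ∈ xs → f x ≡ f y → x ≡ y) → Unique (map f xs)
Unique-map⁺ f {[]}     []         _   = []
Unique-map⁺ f {x ∷ xs} (x∉ ∷ uxs) inj =
  All.map⁺ (All.tabulate λ {y} y∈xs fx≡fy → All.lookup x∉ y∈xs (inj (here refl) (there y∈xs) fx≡fy))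
  ∷ Unique-map⁺ f uxs (λ x∈ y∈ → inj (there x∈) (there y∈))

Unique-∷-above : ∀ {x L} → (∀ {i} → i ∈ L → i < x) → Unique L → Unique (x ∷ L)
Unique-∷-above L<x uL = All.tabulate (λ i∈ → >⇒≢ (L<x i∈)) ∷ uL

interval : ℕ → ℕ → List ℕ
interval b k = applyUpTo (_+ b) k

interval-suc : ∀ b k → interval b (suc k) ≡ b ∷ interval (suc b) k
interval-suc b k = cong (b ∷_) (applyUpTo-cong (λ i → sym (+-suc i b)) k)

∈-interval⁺ : ∀ {b k y} → b ≤ y → y < b + k → y ∈ interval b k
∈-interval⁺ {b} {k} {y} b≤y y<b+k =
  subst (_∈ interval b k) (m∸n+n≡m b≤y)
    (∈-applyUpTo⁺ (_+ b) (+-cancelˡ-< b _ _ (subst (_< b + k) (sym (m+[n∸m]≡n b≤y)) y<b+k)))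

∈-interval⁻ : ∀ {b k y} → y ∈ interval b k → b ≤ y × y < b + k
∈-interval⁻ {b} {k} y∈ with ∈-applyUpTo⁻ (_+ b) y∈
... | i , i<k , refl = m≤n+m b i , subst (i + b <_) (+-comm k b) (+-monoˡ-< b i<k)

Unique-interval : ∀ b k → Unique (interval b k)
Unique-interval b k = Unique.applyUpTo⁺₁ (_+ b) k (λ i<j _ → <⇒≢ i<j ∘ +-cancelʳ-≡ b _ _)

length-interval : ∀ b k → length (interval b k) ≡ k
length-interval b = length-applyUpTo (_+ b)

range≡interval : ∀ j n → range j n ≡ interval j (suc n ∸ j)
range≡interval j n = go (suc n ∸ j) j refl
  where
  go : ∀ k j → suc n ∸ j ≡ k → range j n ≡ interval j k
  go zero    j e rewrite e = refl
  go (suc k) j e with j ≤? n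
  ... | no  j≰n = contradiction (trans (sym (m≤n⇒m∸n≡0 (≰⇒> j≰n))) e) λ ()
  ... | yes j≤n rewrite +-∸-assoc 1 j≤n = trans (cong (j ∷_) (go k (suc j) (suc-injective e))) (sym (interval-suc j k))

length-filter-map : {A B : Set} {P : B → Set} (P? : Decidable P) (f : A → B) (xs : List A) →
  length (filter P? (map f xs)) ≡ length (filter (P? ∘ f) xs)
length-filter-map P? f []       = refl
length-filter-map P? f (x ∷ xs) with does (P? (f x))
... | true  = cong suc (length-filter-map P? f xs)
... | false = length-filter-map P? f xs

m∸1<m : ∀ {m} → 1 ≤ m → m ∸ 1 < m
m∸1<m 1≤m = ∸-monoʳ-< z<s 1≤m

∸-split : ∀ {p j n} → p ≤ j → j ≤ n → (j ∸ p) + (n ∸ j) ≡ n ∸ p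
∸-split {p} {j} {n} p≤j j≤n = begin
  (j ∸ p) + (n ∸ j)   ≡⟨ +-comm (j ∸ p) (n ∸ j) ⟩
  (n ∸ j) + (j ∸ p)   ≡⟨ +-∸-assoc (n ∸ j) p≤j ⟨
  (n ∸ j) + j ∸ p     ≡⟨ cong (_∸ p) (m∸n+n≡m j≤n) ⟩
  n ∸ p               ∎
  where open ≡-Reasoning

1≤m-n⇔n<m : ∀ m n → ℤ.+ 1 ℤ.≤ ℤ.+ m ℤ.- ℤ.+ n ⇔ n < m
1≤m-n⇔n<m m n rewrite ℤ.m-n≡m⊖n m n = mk⇔ to from
  where
  to : ℤ.+ 1 ℤ.≤ m ℤ.⊖ n → n < m
  to 1≤m⊖n with n ≤? m
  ... | yes n≤m rewrite ℤ.⊖-≥ n≤m = subst (1 + n ≤_) (m∸n+n≡m n≤m) (+-monoˡ-≤ n (ℤ.drop‿+≤+ 1≤m⊖n))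
  ... | no  n≰m rewrite ℤ.⊖-< (≰⇒> n≰m) = contradiction (ℤ.≤-trans 1≤m⊖n (ℤ.neg-≤-pos {n = 0})) λ { (ℤ.+≤+ ()) }
  from : n < m → ℤ.+ 1 ℤ.≤ m ℤ.⊖ n
  from n<m rewrite ℤ.⊖-≥ (<⇒≤ n<m) = ℤ.+≤+ (subst (_≤ m ∸ n) (m+n∸n≡m 1 n) (∸-monoˡ-≤ n n<m))

countEq : List ℕ → ℕ → ℕ
countEq xs v = length (filter (_≟ v) xs)

countGe : ℕ → List ℕ → ℕ
countGe j xs = length (filter (j ≤?_) xs)

countGe-split : ∀ v xs → countGe v xs ≡ countEq xs v + countGe (suc v) xs
countGe-split v []       = refl
countGe-split v (x ∷ xs) with <-cmp x v
... | tri< x<v _ _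
  rewrite filter-reject (v ≤?_) {xs = xs} (<⇒≱ x<v) | filter-reject (_≟ v) {xs = xs} (<⇒≢ x<v)
        | filter-reject (suc v ≤?_) {xs = xs} (<⇒≱ (m<n⇒m<1+n x<v))
  = countGe-split v xs
... | tri≈ _ refl _
  rewrite filter-accept (v ≤?_) {xs = xs} ≤-refl | filter-accept (_≟ v) {xs = xs} refl
        | filter-reject (suc v ≤?_) {xs = xs} 1+n≰n
  = cong suc (countGe-split v xs)
... | tri> _ _ v<x
  rewrite filter-accept (v ≤?_) {xs = xs} (<⇒≤ v<x) | filter-reject (_≟ v) {xs = xs} (>⇒≢ v<x)
        | filter-accept (suc v ≤?_) {xs = xs} v<x
  = trans (cong suc (countGe-split v xs)) (sym (+-suc _ _))

countGe-antitone : ∀ v xs → countGe (suc v) xs ≤ countGe v xs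
countGe-antitone v xs rewrite countGe-split v xs = m≤n+m _ _

countGe-beyond : ∀ j xs → (∀ {x} → x ∈ xs → x < j) → countGe j xs ≡ 0
countGe-beyond j xs all<j = cong length (filter-none (j ≤?_) (All.tabulate (<⇒≱ ∘ all<j)))

sum-countEq : ∀ j k xs → (∀ {x} → x ∈ xs → x < j + k) → sum (map (countEq xs) (interval j k)) ≡ countGe j xs
sum-countEq j zero    xs all< = sym (countGe-beyond j xs λ {x} x∈ → subst (x <_) (+-identityʳ j) (all< x∈))
sum-countEq j (suc k) xs all< = begin
  sum (map (countEq xs) (interval j (suc k)))
    ≡⟨ cong (sum ∘ map (countEq xs)) (interval-suc j k) ⟩
  countEq xs j + sum (map (countEq xs) (interval (suc j) k))
    ≡⟨ cong (countEq xs j +_) (sum-countEq (suc j) k xs λ {x} x∈ → subst (x <_) (+-suc j k) (all< x∈)) ⟩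
  countEq xs j + countGe (suc j) xs
    ≡⟨ countGe-split j xs ⟨
  countGe j xs ∎
  where open ≡-Reasoning

countEq-pos : ∀ {x xs} → x ∈ xs → 1 ≤ countEq xs x
countEq-pos {x} x∈xs = ∈⇒1≤length (∈-filter⁺ (_≟ x) x∈xs refl)
  where
  ∈⇒1≤length : ∀ {ys} → x ∈ ys → 1 ≤ length ys
  ∈⇒1≤length (here _)  = s≤s z≤n
  ∈⇒1≤length (there _) = s≤s z≤n

countGe-shift : ∀ d p xs → (∀ w → p ≤ w → w < p + d → w ∈ xs) → d + countGe (p + d) xs ≤ countGe p xs
countGe-shift zero    p xs _    = ≤-reflexive (cong (λ j → countGe j xs) (+-identityʳ p))
countGe-shift (suc d) p xs all∈ = begin
  suc d + countGe (p + suc d) xs      ≡⟨ cong (λ j → suc d + countGe j xs) (+-suc p d) ⟩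
  1 + (d + countGe (suc p + d) xs)    ≤⟨ +-mono-≤ (countEq-pos (all∈ p ≤-refl (m<m+n p z<s))) shifted ⟩
  countEq xs p + countGe (suc p) xs   ≡⟨ countGe-split p xs ⟨
  countGe p xs                        ∎
  where
  open ≤-Reasoning
  shifted : d + countGe (suc p + d) xs ≤ countGe (suc p) xs
  shifted = countGe-shift d (suc p) xs λ w p<w w< → all∈ w (<⇒≤ p<w) (subst (w <_) (sym (+-suc p d)) w<)

-- Intervals in a predicate

module _ {P : ℕ → Set} where

  IsIntervalIn-single : ∀ {m} → P m → IsIntervalIn P m m
  IsIntervalIn-single pm = ≤-refl , λ y m≤y y≤m → subst P (≤-antisym m≤y y≤m) pm

  IsIntervalIn-cons : ∀ {m q} → P m → IsIntervalIn P (suc m) q → IsIntervalIn P m q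
  IsIntervalIn-cons {m} pm (m<q , all) = <⇒≤ m<q , λ y m≤y y≤q → case m ≟ y of λ where
    (yes refl) → pm
    (no m≢y)   → all y (≤∧≢⇒< m≤y m≢y) y≤q

  IsIntervalIn-snoc : ∀ {p m} → IsIntervalIn P p m → P (suc m) → IsIntervalIn P p (suc m)
  IsIntervalIn-snoc (p≤m , all) pm = m≤n⇒m≤1+n p≤m , λ y p≤y y≤1+m → case m≤n⇒m<n∨m≡n y≤1+m of λ where
    (inj₁ y<1+m) → all y p≤y (≤-pred y<1+m)
    (inj₂ refl)  → pm

IsIntervalIn-map : ∀ {P Q : ℕ → Set} {p q} → (∀ {j} → P j → Q j) → IsIntervalIn P p q → IsIntervalIn Q p q
IsIntervalIn-map P⇒Q (p≤q , all) = p≤q , λ j p≤j j≤q → P⇒Q (all j p≤j j≤q)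

IsMaximalInterval-⇔ : ∀ {P Q : ℕ → Set} {p q} → (∀ j → P j ⇔ Q j) → IsMaximalInterval P p q → IsMaximalInterval Q p q
IsMaximalInterval-⇔ P⇔Q (interval , maximal) =
  IsIntervalIn-map (λ {j} → Equivalence.to (P⇔Q j)) interval ,
  λ p′ q′ interval′ → maximal p′ q′ (IsIntervalIn-map (λ {j} → Equivalence.from (P⇔Q j)) interval′)

module _ {P : ℕ → Set} (P? : Decidable P) where

  ∃<? : ∀ m → Dec (∃ λ i → i < m × P i)
  ∃<? m with any? P? (upTo m)
  ... | yes some = let i , i∈ , pi = find some in yes (i , ∈-upTo⁻ i∈ , pi)
  ... | no none  = no λ (i , i<m , pi) → none (lose (∈-upTo⁺ i<m) pi)

  runDown : ∀ m → P m → ∃ λ p → IsIntervalIn P p m × (p ≡ 0 ⊎ ¬ P (p ∸ 1))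
  runDown zero    p0 = 0 , IsIntervalIn-single p0 , inj₁ refl
  runDown (suc m) pm with P? m
  ... | no ¬pm = suc m , IsIntervalIn-single pm , inj₂ ¬pm
  ... | yes pm′ with runDown m pm′
  ...   | p , run , stop = p , IsIntervalIn-snoc run pm , stop

  runUp : ∀ {b} → (∀ y → P y → y ≤ b) → ∀ k m → k + m ≡ b → P m → ∃ λ q → IsIntervalIn P m q × ¬ P (suc q)
  runUp bound k m k+m≡b pm with P? (suc m)
  ... | no ¬pm = m , IsIntervalIn-single pm , ¬pm
  ... | yes pm′ with k
  ...   | zero  = contradiction (bound (suc m) pm′) (subst (suc m ≰_) k+m≡b 1+n≰n)
  ...   | suc k with runUp bound k (suc m) (trans (+-suc k m) k+m≡b) pm′
  ...     | q , run , stop = q , IsIntervalIn-cons pm run , stop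

  maximalIntervalAround : ∀ {b j} → (∀ y → P y → y ≤ b) → P j →
    ∃ λ p → ∃ λ q → p ≤ j × j ≤ q × IsMaximalInterval P p q
  maximalIntervalAround {b} {j} bound pj with runDown j pj | runUp bound (b ∸ j) j (m∸n+n≡m (bound j pj)) pj
  ... | p , (p≤j , below) , stopDown | q , (j≤q , above) , stopUp =
    p , q , p≤j , j≤q , (≤-trans p≤j j≤q , all) , maximal
    where
    all : ∀ y → p ≤ y → y ≤ q → P y
    all y p≤y y≤q with y ≤? j
    ... | yes y≤j = below y p≤y y≤j
    ... | no  y≰j = above y (<⇒≤ (≰⇒> y≰j)) y≤q
    maximal : ∀ p′ q′ → IsIntervalIn P p′ q′ → p′ ≤ p → q ≤ q′ → p′ ≡ p × q′ ≡ q
    maximal p′ q′ (_ , all′) p′≤p q≤q′ = ≤-antisym p′≤p p≤p′ , ≤-antisym q′≤q q≤q′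
      where
      p≤p′ : p ≤ p′
      p≤p′ with p′ <? p
      ... | no  p′≮p = ≮⇒≥ p′≮p
      ... | yes p′<p = case stopDown of λ where
        (inj₁ refl)  → contradiction p′<p λ ()
        (inj₂ ¬pred) → contradiction
          (all′ (p ∸ 1) (∸-monoˡ-≤ 1 p′<p) (≤-trans (m∸n≤m p 1) (≤-trans p≤j (≤-trans j≤q q≤q′)))) ¬pred
      q′≤q : q′ ≤ q
      q′≤q with q <? q′
      ... | no  q≮q′ = ≮⇒≥ q≮q′
      ... | yes q<q′ = contradiction (all′ (suc q) (≤-trans p′≤p (≤-trans p≤j (≤-trans j≤q (n≤1+n q)))) q<q′) stopUp

-- A single car

module _ {n : ℕ} {O : List ℕ} where

  freeSpot-true : ∀ {x} → freeSpot n O x ≡ true → (1 ≤ x × x ≤ n) × occupied O x ≡ false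
  freeSpot-true {x} e with 1 ≤ᵇ x in e₁ | x ≤ᵇ n in e₂ | occupied O x
  ... | true | true | false = (≤ᵇ⇒≤ 1 x (Equivalence.from T-≡ e₁) , ≤ᵇ⇒≤ x n (Equivalence.from T-≡ e₂)) , refl

  freeSpot-intro : ∀ {x} → 1 ≤ x → x ≤ n → occupied O x ≡ false → freeSpot n O x ≡ true
  freeSpot-intro 1≤x x≤n e rewrite Equivalence.to T-≡ (≤⇒≤ᵇ 1≤x) | Equivalence.to T-≡ (≤⇒≤ᵇ x≤n) | e = refl

  freeSpot-false : ∀ {x} → 1 ≤ x → x ≤ n → freeSpot n O x ≡ false → occupied O x ≡ true
  freeSpot-false 1≤x x≤n e = ¬-not λ eo → contradiction (trans (sym e) (freeSpot-intro 1≤x x≤n eo)) λ ()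

  Blocked : ℕ → ℕ → Set
  Blocked b e = ∀ y → b ≤ y → y < e → freeSpot n O y ≡ false

  Blocked-empty : ∀ {b} → Blocked b b
  Blocked-empty y b≤y y<b = contradiction (≤-<-trans b≤y y<b) (<-irrefl refl)

  Blocked-cons : ∀ {b e} → freeSpot n O b ≡ false → Blocked (suc b) e → Blocked b e
  Blocked-cons {b} notFree blocked y b≤y y<e with b ≟ y
  ... | yes refl = notFree
  ... | no b≢y   = blocked y (≤∧≢⇒< b≤y b≢y) y<e

  firstFreeFrom-just : ∀ b k {s} → firstFreeFrom n O b k ≡ just s → freeSpot n O s ≡ true × b ≤ s × Blocked b s
  firstFreeFrom-just b (suc k) e with freeSpot n O b in eb
  firstFreeFrom-just b (suc k) refl | true = eb , ≤-refl , Blocked-empty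
  ... | false with firstFreeFrom-just (suc b) k e
  ... | free , b<s , blocked = free , <⇒≤ b<s , Blocked-cons eb blocked

  firstFreeFrom-nothing : ∀ b k → firstFreeFrom n O b k ≡ nothing → Blocked b (b + k)
  firstFreeFrom-nothing b zero    _ = subst (Blocked b) (sym (+-identityʳ b)) Blocked-empty
  firstFreeFrom-nothing b (suc k) e with freeSpot n O b in eb
  ... | false = subst (Blocked b) (sym (+-suc b k)) (Blocked-cons eb (firstFreeFrom-nothing (suc b) k e))

  data ParkCase (a : ℕ) (r : Bool) (s : ℕ) : Set where
    atPreference : s ≡ a → ParkCase a r s
    backward     : s ≡ a ∸ 1 → r ≡ true → 2 ≤ a → freeSpot n O a ≡ false → ParkCase a r s
    forward      : a < s → Blocked a s → ParkCase a r s

  parkSpot-just : ∀ a r {s} → parkSpot n O a r ≡ just s → freeSpot n O s ≡ true × ParkCase a r s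
  parkSpot-just a r e with freeSpot n O a in ea
  parkSpot-just a r refl | true = ea , atPreference refl
  ... | false with r ∧ (2 ≤ᵇ a) ∧ freeSpot n O (a ∸ 1) in eb
  parkSpot-just a r refl | false | true =
    ∧-conicalʳ (2 ≤ᵇ a) _ rest , backward refl (∧-conicalˡ r _ eb) (≤ᵇ⇒≤ 2 a (Equivalence.from T-≡ (∧-conicalˡ _ _ rest))) ea
    where rest = ∧-conicalʳ r ((2 ≤ᵇ a) ∧ freeSpot n O (a ∸ 1)) eb
  parkSpot-just a r e | false | false with firstFreeFrom-just (suc a) n e
  ... | free , a<s , blocked = free , forward a<s (Blocked-cons ea blocked)

  parkSpot-nothing : ∀ a r → parkSpot n O a r ≡ nothing → ∀ y → a ≤ y → y ≤ n → freeSpot n O y ≡ false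
  parkSpot-nothing a r e y a≤y y≤n with freeSpot n O a in ea
  ... | false with r ∧ (2 ≤ᵇ a) ∧ freeSpot n O (a ∸ 1)
  ... | false = Blocked-cons ea (firstFreeFrom-nothing (suc a) n e) y a≤y (s≤s (≤-trans y≤n (m≤n+m n a)))

  parkSpot-free : ∀ a r → freeSpot n O a ≡ true → parkSpot n O a r ≡ just a
  parkSpot-free a r e rewrite e = refl

  parkSpot-back : ∀ a → freeSpot n O a ≡ false → 2 ≤ a → freeSpot n O (a ∸ 1) ≡ true → parkSpot n O a true ≡ just (a ∸ 1)
  parkSpot-back a e₁ 2≤a e₂ rewrite e₁ | Equivalence.to T-≡ (≤⇒≤ᵇ 2≤a) | e₂ = refl

-- The parking process

module Parking (n : ℕ) (A : ℕ → ℕ) (R : ℕ → Bool) where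

  occupancy : ℕ → List ℕ
  occupancy zero    = []
  occupancy (suc t) = maybe′ (_∷ occupancy t) (occupancy t) (parkSpot n (occupancy t) (A t) (R t))

  spot : ℕ → Maybe ℕ
  spot t = parkSpot n (occupancy t) (A t) (R t)

  Free : ℕ → ℕ → Bool
  Free t = freeSpot n (occupancy t)

  Taken : ℕ → ℕ → Set
  Taken t x = ∃ λ i → i < t × spot i ≡ just x

  Taken? : ∀ t → Decidable (Taken t)
  Taken? t x = ∃<? (λ i → ≡-dec _≟_ (spot i) (just x)) t

  Taken-mono : ∀ {t t′ x} → t ≤ t′ → Taken t x → Taken t′ x
  Taken-mono t≤t′ (i , i<t , si) = i , <-≤-trans i<t t≤t′ , si

  occupancy-suc : ∀ {t s} → spot t ≡ just s → occupancy (suc t) ≡ s ∷ occupancy t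
  occupancy-suc {t} = cong (maybe′ (_∷ occupancy t) (occupancy t))

  occupied⇒Taken : ∀ t x → occupied (occupancy t) x ≡ true → Taken t x
  occupied⇒Taken (suc t) x e with spot t in st
  ... | nothing = Taken-mono (n≤1+n t) (occupied⇒Taken t x e)
  ... | just s with s ≡ᵇ x in s≡ᵇx
  ... | true  = t , ≤-refl , trans st (cong just (≡ᵇ⇒≡ s x (Equivalence.from T-≡ s≡ᵇx)))
  ... | false = Taken-mono (n≤1+n t) (occupied⇒Taken t x e)

  Taken⇒occupied : ∀ t x → Taken t x → occupied (occupancy t) x ≡ true
  Taken⇒occupied (suc t) x (i , i<1+t , si) with spot t in st | m<1+n⇒m<n∨m≡n i<1+t
  ... | nothing | inj₁ i<t  = Taken⇒occupied t x (i , i<t , si)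
  ... | nothing | inj₂ refl = contradiction (trans (sym si) st) λ ()
  ... | just s  | inj₁ i<t  rewrite Taken⇒occupied t x (i , i<t , si) = ∨-zeroʳ (s ≡ᵇ x)
  ... | just s  | inj₂ refl with trans (sym st) si
  ... | refl rewrite Equivalence.to T-≡ (≡⇒≡ᵇ x x refl) = refl

  free⇒¬Taken : ∀ {t x} → Free t x ≡ true → ¬ Taken t x
  free⇒¬Taken {t} {x} e tk =
    contradiction (trans (sym (proj₂ (freeSpot-true {O = occupancy t} e))) (Taken⇒occupied t x tk)) λ ()

  Taken⇒notFree : ∀ {t x} → Taken t x → Free t x ≡ false
  Taken⇒notFree tk = ¬-not λ free → free⇒¬Taken free tk

  ¬Taken⇒free : ∀ {t x} → 1 ≤ x → x ≤ n → ¬ Taken t x → Free t x ≡ true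
  ¬Taken⇒free {t} {x} 1≤x x≤n ¬tk = freeSpot-intro {O = occupancy t} 1≤x x≤n (¬-not (¬tk ∘ occupied⇒Taken t x))

  notFree⇒Taken : ∀ {t x} → 1 ≤ x → x ≤ n → Free t x ≡ false → Taken t x
  notFree⇒Taken {t} {x} 1≤x x≤n e = occupied⇒Taken t x (freeSpot-false {O = occupancy t} 1≤x x≤n e)

  spot-free : ∀ {t s} → spot t ≡ just s → Free t s ≡ true
  spot-free {t} st = proj₁ (parkSpot-just (A t) (R t) st)

  spot-inRange : ∀ {t s} → spot t ≡ just s → 1 ≤ s × s ≤ n
  spot-inRange {t} st = proj₁ (freeSpot-true {O = occupancy t} (spot-free st))

  ¬Taken-0 : ∀ {t} → ¬ Taken t 0
  ¬Taken-0 (_ , _ , si) = contradiction (proj₁ (spot-inRange si)) λ ()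

  spot-injective : ∀ {i i′ x} → spot i ≡ just x → spot i′ ≡ just x → i ≡ i′
  spot-injective {i} {i′} si si′ with <-cmp i i′
  ... | tri< i<i′ _ _ = contradiction (i , i<i′ , si) (free⇒¬Taken (spot-free si′))
  ... | tri≈ _ i≡i′ _ = i≡i′
  ... | tri> _ _ i′<i = contradiction (i′ , i′<i , si′) (free⇒¬Taken (spot-free si))

  ParkedFrom : ℕ → ℕ → Set
  ParkedFrom t k = ∀ d → d < k → ∃ λ s → spot (d + t) ≡ just s

  runCars⇒ParkedFrom : ∀ t xs bs → (∀ i → at 0 xs i ≡ A (i + t)) → (∀ i → at false bs i ≡ R (i + t)) →
    is-just (runCars n (occupancy t) xs bs) ≡ true → ParkedFrom t (length xs)
  runCars⇒ParkedFrom t (x ∷ xs) (b ∷ bs) xs≗A bs≗R e d d<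
    with refl ← xs≗A 0 | refl ← bs≗R 0 | spot t in st
  ... | just s with d
  ...   | zero  = s , st
  ...   | suc d = subst (λ i → ∃ λ s → spot i ≡ just s) (+-suc d t)
                    (runCars⇒ParkedFrom (suc t) xs bs (at-shift A xs≗A) (at-shift R bs≗R)
                      (subst (λ O → is-just (runCars n O xs bs) ≡ true) (sym (occupancy-suc st)) e) d (s≤s⁻¹ d<))

  ParkedFrom⇒runCars : ∀ t xs bs → (∀ i → at 0 xs i ≡ A (i + t)) → (∀ i → at false bs i ≡ R (i + t)) →
    length xs ≡ length bs → ParkedFrom t (length xs) → is-just (runCars n (occupancy t) xs bs) ≡ true
  ParkedFrom⇒runCars t []       bs       _    _    _         _      = refl
  ParkedFrom⇒runCars t (x ∷ xs) (b ∷ bs) xs≗A bs≗R |xs|≡|bs| parked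
    with refl ← xs≗A 0 | refl ← bs≗R 0 | spot t in st
  ... | nothing = contradiction (trans (sym st) (proj₂ (parked 0 z<s))) λ ()
  ... | just s  =
    subst (λ O → is-just (runCars n O xs bs) ≡ true) (occupancy-suc st)
      (ParkedFrom⇒runCars (suc t) xs bs (at-shift A xs≗A) (at-shift R bs≗R) (suc-injective |xs|≡|bs|)
        λ d d< → subst (λ i → ∃ λ s → spot i ≡ just s) (sym (+-suc d t)) (parked (suc d) (s≤s d<)))

  AllPark : Set
  AllPark = ∀ t → t < n → ∃ λ s → spot t ≡ just s

  finalSpot : ℕ → ℕ
  finalSpot i = fromMaybe 0 (spot i)

  finalSpot-spot : ∀ {i s} → spot i ≡ just s → finalSpot i ≡ s
  finalSpot-spot si rewrite si = refl

  spot≡finalSpot : AllPark → ∀ {i} → i < n → spot i ≡ just (finalSpot i)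
  spot≡finalSpot allPark i<n with allPark _ i<n
  ... | s , si = trans si (cong just (sym (finalSpot-spot si)))

  prefs : List ℕ
  prefs = applyUpTo A n

  -- The counting form of j ∈ U_α: more cars prefer a spot ≥ j than the n - j + 1 spots ≥ j.
  Crowded : ℕ → Set
  Crowded j = (1 ≤ j × j ≤ n) × suc (n ∸ j) < countGe j prefs

  Crowded? : Decidable Crowded
  Crowded? j = ((1 ≤? j) ×-dec (j ≤? n)) ×-dec (suc (n ∸ j) <? countGe j prefs)

  Crowded⇒≤n : ∀ j → Crowded j → j ≤ n
  Crowded⇒≤n j ((_ , j≤n) , _) = j≤n

  countGe-prefs≤n : ∀ j → countGe j prefs ≤ n
  countGe-prefs≤n j = subst (countGe j prefs ≤_) (length-applyUpTo A n) (length-filter (j ≤?_) prefs)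

  ¬Crowded-1 : ¬ Crowded 1
  ¬Crowded-1 (_ , crowded) = <⇒≱ crowded (≤-trans (countGe-prefs≤n 1) (m≤n+m∸n n 1))

  prefAtLeast : ℕ → ℕ → List ℕ
  prefAtLeast j t = filter (λ i → j ≤? A i) (upTo t)

  ∈-prefAtLeast⁺ : ∀ {j t i} → i < t → j ≤ A i → i ∈ prefAtLeast j t
  ∈-prefAtLeast⁺ {j} i<t = ∈-filter⁺ (λ i → j ≤? A i) (∈-upTo⁺ i<t)

  ∈-prefAtLeast⁻ : ∀ {j t i} → i ∈ prefAtLeast j t → i < t × j ≤ A i
  ∈-prefAtLeast⁻ {j} {t} i∈ with ∈-filter⁻ (λ i → j ≤? A i) {xs = upTo t} i∈
  ... | i∈upTo , j≤Ai = ∈-upTo⁻ i∈upTo , j≤Ai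

  Unique-prefAtLeast : ∀ j t → Unique (prefAtLeast j t)
  Unique-prefAtLeast j t = Unique.filter⁺ (λ i → j ≤? A i) (Unique.upTo⁺ t)

  countGe-prefs : ∀ j → countGe j prefs ≡ length (prefAtLeast j n)
  countGe-prefs j = trans (cong (countGe j) (sym (map-upTo A n))) (length-filter-map (j ≤?_) A (upTo n))

  length≤countGe-prefs : ∀ {L j} → Unique L → (∀ {i} → i ∈ L → i < n × j ≤ A i) → length L ≤ countGe j prefs
  length≤countGe-prefs {j = j} uL L⊆ = subst (_ ≤_) (sym (countGe-prefs j))
    (Unique-⊆⇒length≤ _≟_ uL λ i∈ → let i<n , j≤Ai = L⊆ i∈ in ∈-prefAtLeast⁺ i<n j≤Ai)

  spotsTaken⇒prefAtLeast : ∀ {j t} → j ≤ n → (∀ y → j ≤ y → y ≤ n → Taken t y) →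
    (∀ {i s} → i < t → spot i ≡ just s → j ≤ s → j ≤ A i) → suc (n ∸ j) ≤ length (prefAtLeast j t)
  spotsTaken⇒prefAtLeast {j} {t} j≤n taken prefers = begin
    suc (n ∸ j)                       ≡⟨ +-∸-assoc 1 j≤n ⟨
    suc n ∸ j                         ≡⟨ length-interval j (suc n ∸ j) ⟨
    length (interval j (suc n ∸ j))   ≤⟨ Unique-⊆⇒length≤ _≟_ (Unique-interval j _) covered ⟩
    length (map finalSpot L)          ≡⟨ length-map finalSpot L ⟩
    length L                          ∎
    where
    open ≤-Reasoning
    L = prefAtLeast j t
    covered : interval j (suc n ∸ j) ⊆ map finalSpot L
    covered {y} y∈ with ∈-interval⁻ y∈
    ... | j≤y , y< with taken y j≤y (≤-pred (subst (y <_) (m+[n∸m]≡n (m≤n⇒m≤1+n j≤n)) y<))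
    ...   | i , i<t , si =
      subst (_∈ map finalSpot L) (finalSpot-spot si) (∈-map⁺ finalSpot (∈-prefAtLeast⁺ i<t (prefers i<t si j≤y)))

  -- The indices j₁ < j₂ < ⋯ of the theorem: head is j₁, and link w is the 1-Naples car preferring w.
  record Chain (p T : ℕ) : Set where
    field
      head            : ℕ
      link            : ℕ → ℕ
      A-head          : A head ≡ T
      head<link       : ∀ {w} → p ≤ w → w ≤ T → head < link w
      link<n          : ∀ {w} → p ≤ w → w ≤ T → link w < n
      A-link          : ∀ {w} → p ≤ w → w ≤ T → A (link w) ≡ w
      R-link          : ∀ {w} → p ≤ w → w ≤ T → R (link w) ≡ true
      link-decreasing : ∀ {w w′} → p ≤ w → w < w′ → w′ ≤ T → link w′ < link w

  Chain-single : ∀ {x b v} → x < b → b < n → A x ≡ v → A b ≡ v → R b ≡ true → Chain v v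
  Chain-single {x} {b} x<b b<n Ax≡v Ab≡v Rb≡true = record
    { head = x ; link = λ _ → b ; A-head = Ax≡v
    ; head<link = λ _ _ → x<b ; link<n = λ _ _ → b<n
    ; A-link = λ v≤w w≤v → trans Ab≡v (≤-antisym v≤w w≤v)
    ; R-link = λ _ _ → Rb≡true
    ; link-decreasing = λ v≤w w<w′ w′≤v → contradiction (≤-<-trans v≤w w<w′) (≤⇒≯ w′≤v) }

  Chain-extend : ∀ {v T b} (c : Chain (suc v) T) → suc v ≤ T → Chain.link c (suc v) < b → b < n → A b ≡ v → R b ≡ true →
    Σ (Chain v T) λ c′ → Chain.head c′ ≡ Chain.head c × Chain.link c′ v ≡ b
  Chain-extend {v} {T} {b} c 1+v≤T x<b b<n Ab≡v Rb≡true = record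
    { head = head ; link = link′ ; A-head = A-head
    ; head<link = λ v≤w w≤T → on v≤w w≤T (λ _ c → head < c) (<-trans (head<link ≤-refl 1+v≤T) x<b) head<link
    ; link<n = λ v≤w w≤T → on v≤w w≤T (λ _ c → c < n) b<n link<n
    ; A-link = λ v≤w w≤T → on v≤w w≤T (λ w c → A c ≡ w) Ab≡v A-link
    ; R-link = λ v≤w w≤T → on v≤w w≤T (λ _ c → R c ≡ true) Rb≡true R-link
    ; link-decreasing = decreasing } , refl , link′-v
    where
    open Chain c
    link′ : ℕ → ℕ
    link′ w = if does (w ≤? v) then b else link w
    link′-v : link′ v ≡ b
    link′-v rewrite dec-true (v ≤? v) ≤-refl = refl
    link′-above : ∀ {w} → v < w → link′ w ≡ link w
    link′-above v<w rewrite dec-false (_ ≤? v) (<⇒≱ v<w) = refl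
    on : ∀ {w} → v ≤ w → w ≤ T → (P : ℕ → ℕ → Set) → P v b → (∀ {w} → suc v ≤ w → w ≤ T → P w (link w)) → P w (link′ w)
    on v≤w w≤T P pb plink with m≤n⇒m<n∨m≡n v≤w
    ... | inj₁ v<w  = subst (P _) (sym (link′-above v<w)) (plink v<w w≤T)
    ... | inj₂ refl = subst (P _) (sym link′-v) pb
    link<b : ∀ {w} → suc v ≤ w → w ≤ T → link w < b
    link<b 1+v≤w w≤T with m≤n⇒m<n∨m≡n 1+v≤w
    ... | inj₁ 1+v<w = <-trans (link-decreasing ≤-refl 1+v<w w≤T) x<b
    ... | inj₂ refl  = x<b
    decreasing : ∀ {w w′} → v ≤ w → w < w′ → w′ ≤ T → link′ w′ < link′ w
    decreasing v≤w w<w′ w′≤T with m≤n⇒m<n∨m≡n v≤w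
    ... | inj₁ v<w  rewrite link′-above v<w | link′-above (<-trans v<w w<w′) = link-decreasing v<w w<w′ w′≤T
    ... | inj₂ refl rewrite link′-v | link′-above w<w′ = link<b w<w′ w′≤T

  MaximalChains : Set
  MaximalChains = ∀ p q → IsMaximalInterval Crowded p q → ∃ λ T → q ≤ T × Chain p T

  maximal⇒¬overcrowded : ∀ {p q} → IsMaximalInterval Crowded p q → ¬ suc (suc (n ∸ p)) < countGe p prefs
  maximal⇒¬overcrowded {zero} ((0≤q , crowded) , _) _ with crowded 0 ≤-refl 0≤q
  ... | (() , _) , _
  maximal⇒¬overcrowded {suc zero} _ over =
    <⇒≱ over (≤-trans (countGe-prefs≤n 1) (≤-trans (m≤n+m∸n n 1) (n≤1+n _)))
  maximal⇒¬overcrowded {suc (suc p)} {q} ((p≤q , crowded) , maximal) over =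
    contradiction (proj₁ (maximal (suc p) q (IsIntervalIn-cons crowded-p (p≤q , crowded)) (n≤1+n _) ≤-refl)) (<⇒≢ (n<1+n _))
    where
    2+p≤n : suc (suc p) ≤ n
    2+p≤n = Crowded⇒≤n _ (crowded _ ≤-refl p≤q)
    crowded-p : Crowded (suc p)
    crowded-p = (s≤s z≤n , <⇒≤ 2+p≤n) ,
      <-≤-trans (subst (λ k → suc k < countGe (suc (suc p)) prefs) (sym (+-∸-assoc 1 2+p≤n)) over)
                (countGe-antitone (suc p) prefs)

  module _ (valid : ∀ {i} → i < n → 1 ≤ A i × A i ≤ n) where

    data ParkedVia (t s : ℕ) : Set where
      atPreference : s ≡ A t → ParkedVia t s
      backward     : s ≡ A t ∸ 1 → R t ≡ true → 2 ≤ A t → Taken t (A t) → ParkedVia t s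
      forward      : A t < s → (∀ y → A t ≤ y → y < s → Taken t y) → ParkedVia t s

    parkedVia : ∀ {t s} → t < n → spot t ≡ just s → ParkedVia t s
    parkedVia {t} t<n st with valid t<n | parkSpot-just (A t) (R t) st
    ... | _   , _   | _ , atPreference s≡a               = atPreference s≡a
    ... | 1≤a , a≤n | _ , backward s≡a-1 r≡true 2≤a busy = backward s≡a-1 r≡true 2≤a (notFree⇒Taken 1≤a a≤n busy)
    ... | 1≤a , _   | _ , forward a<s blocked            = forward a<s λ y a≤y y<s →
      notFree⇒Taken (≤-trans 1≤a a≤y) (<⇒≤ (<-≤-trans y<s (proj₂ (spot-inRange st)))) (blocked y a≤y y<s)

    stuck : ∀ {t} → t < n → spot t ≡ nothing → ∀ y → A t ≤ y → y ≤ n → Taken t y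
    stuck {t} t<n st y a≤y y≤n =
      notFree⇒Taken (≤-trans (proj₁ (valid t<n)) a≤y) y≤n (parkSpot-nothing (A t) (R t) st y a≤y y≤n)

    spot-atPreference : ∀ {t} → t < n → ¬ Taken t (A t) → spot t ≡ just (A t)
    spot-atPreference {t} t<n ¬tk = parkSpot-free (A t) (R t) (¬Taken⇒free (proj₁ (valid t<n)) (proj₂ (valid t<n)) ¬tk)

    spot-backward : ∀ {t j} → t < n → A t ≡ j → R t ≡ true → 2 ≤ j → Taken t j → ¬ Taken t (j ∸ 1) → spot t ≡ just (j ∸ 1)
    spot-backward {t} t<n refl r≡true 2≤a tk ¬tk rewrite r≡true =
      parkSpot-back (A t) (Taken⇒notFree tk) 2≤a
        (¬Taken⇒free (∸-monoˡ-≤ 1 2≤a) (≤-trans (m∸n≤m (A t) 1) (proj₂ (valid t<n))) ¬tk)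

    crowded⇒backwardParker : AllPark → ∀ {j} → Crowded j → ∃ λ b → b < n × A b ≡ j × spot b ≡ just (j ∸ 1)
    crowded⇒backwardParker allPark {j} ((_ , j≤n) , crowded)
      with ∃<? (λ b → (A b ≟ j) ×-dec ≡-dec _≟_ (spot b) (just (j ∸ 1))) n
    ... | yes (b , b<n , Ab≡j , sb) = b , b<n , Ab≡j , sb
    ... | no none = contradiction crowded (≤⇒≯ (begin
      countGe j prefs                     ≡⟨ countGe-prefs j ⟩
      length L                            ≡⟨ length-map finalSpot L ⟨
      length (map finalSpot L)            ≤⟨ Unique-⊆⇒length≤ _≟_ uniqueSpots spots⊆ ⟩
      length (interval j (suc n ∸ j))     ≡⟨ length-interval j (suc n ∸ j) ⟩
      suc n ∸ j                           ≡⟨ +-∸-assoc 1 j≤n ⟩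
      suc (n ∸ j)                         ∎))
      where
      open ≤-Reasoning
      L = prefAtLeast j n
      uniqueSpots : Unique (map finalSpot L)
      uniqueSpots = Unique-map⁺ finalSpot (Unique-prefAtLeast j n) λ x∈ y∈ fx≡fy →
        spot-injective (spot≡finalSpot allPark (proj₁ (∈-prefAtLeast⁻ x∈)))
                       (trans (spot≡finalSpot allPark (proj₁ (∈-prefAtLeast⁻ y∈))) (cong just (sym fx≡fy)))
      parksFrom-j : ∀ {i} → i < n → j ≤ A i → j ≤ finalSpot i
      parksFrom-j {i} i<n j≤Ai with spot≡finalSpot allPark i<n
      ... | si with parkedVia i<n si
      ...   | atPreference s≡a = subst (j ≤_) (sym s≡a) j≤Ai
      ...   | forward a<s _    = <⇒≤ (≤-<-trans j≤Ai a<s)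
      ...   | backward s≡a-1 _ _ _ with A i ≟ j
      ...     | yes Ai≡j = contradiction (i , i<n , Ai≡j , trans si (cong just (trans s≡a-1 (cong (_∸ 1) Ai≡j)))) none
      ...     | no  Ai≢j = subst (j ≤_) (sym s≡a-1) (∸-monoˡ-≤ 1 (≤∧≢⇒< j≤Ai (Ai≢j ∘ sym)))
      spots⊆ : map finalSpot L ⊆ interval j (suc n ∸ j)
      spots⊆ s∈ with ∈-map⁻ finalSpot s∈
      ... | i , i∈L , refl with ∈-prefAtLeast⁻ i∈L
      ...   | i<n , j≤Ai = ∈-interval⁺ (parksFrom-j i<n j≤Ai)
                (<-≤-trans (s≤s (proj₂ (spot-inRange (spot≡finalSpot allPark i<n)))) (m≤n+m∸n (suc n) j))

    backwardChain : ∀ {v} b → Acc _<_ b → b < n → A b ≡ v → spot b ≡ just (v ∸ 1) →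
      ∃ λ T → v ≤ T × Σ (Chain v T) λ c → spot (Chain.head c) ≡ just T × Chain.link c v ≡ b
    backwardChain b (acc rec) b<n refl sb with valid b<n | parkedVia b<n sb
    ... | 1≤Ab , _ | atPreference Ab-1≡Ab = contradiction Ab-1≡Ab (<⇒≢ (m∸1<m 1≤Ab))
    ... | 1≤Ab , _ | forward Ab<Ab-1 _   = contradiction Ab<Ab-1 (<⇒≯ (m∸1<m 1≤Ab))
    ... | 1≤Ab , _ | backward _ Rb≡true _ (x , x<b , sx) with parkedVia (<-trans x<b b<n) sx
    ...   | atPreference Ab≡Ax = A b , ≤-refl , Chain-single x<b b<n (sym Ab≡Ax) refl Rb≡true , sx , refl
    ...   | forward Ax<Ab blocked = contradiction
      (Taken-mono (<⇒≤ x<b) (blocked (A b ∸ 1) (∸-monoˡ-≤ 1 Ax<Ab) (m∸1<m 1≤Ab))) (free⇒¬Taken (spot-free sb))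
    ...   | backward Ab≡Ax-1 _ 2≤Ax _
      with backwardChain x (rec x<b) (<-trans x<b b<n)
             (trans (+-∸-assoc 1 (≤-trans (n≤1+n 1) 2≤Ax)) (cong suc (sym Ab≡Ax-1))) sx
    ...     | T , 1+Ab≤T , c , sHead , link≡x
      with Chain-extend c 1+Ab≤T (subst (_< b) (sym link≡x) x<b) b<n refl Rb≡true
    ...       | c′ , head≡ , link≡b = T , <⇒≤ 1+Ab≤T , c′ , subst (λ h → spot h ≡ just T) (sym head≡) sHead , link≡b

    onlyIf : AllPark → ∀ {p q} → IsIntervalIn Crowded p q → ∃ λ T → q ≤ T × Chain p T
    onlyIf allPark {p} {q} (p≤q , crowded) with crowded⇒backwardParker allPark (crowded p ≤-refl p≤q)
    ... | b , b<n , Ab≡p , sb with backwardChain b (<-wellFounded b) b<n Ab≡p sb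
    ... | T , p≤T , c , sHead , _ = T , q≤T , c
      where
      open Chain c
      q≤T : q ≤ T
      q≤T with q ≤? T
      ... | yes q≤T = q≤T
      ... | no  q≰T with crowded⇒backwardParker allPark (crowded (suc T) (≤-trans p≤T (n≤1+n T)) (≰⇒> q≰T))
      ...   | y , _ , Ay≡1+T , sy =
        contradiction (trans (sym A-head) (trans (cong A (spot-injective sHead sy)) Ay≡1+T)) (<⇒≢ (n<1+n T))

    fallbackFreeLater⇒preferenceFree : ∀ {c t′ w} → c < n → A c ≡ suc w → R c ≡ true → 1 ≤ w → c < t′ →
      ¬ Taken t′ w → ¬ Taken c (suc w)
    fallbackFreeLater⇒preferenceFree c<n Ac≡1+w Rc≡true 1≤w c<t′ ¬later busy =
      ¬later (_ , c<t′ , spot-backward c<n Ac≡1+w Rc≡true (s≤s 1≤w) busy (¬later ∘ Taken-mono (<⇒≤ c<t′)))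

    -- Each link finds its preferred spot free, so spot T is still free when link T arrives,
    -- after the head parked there.
    Chain-earlyLink⇒⊥ : ∀ {p T j t} (c : Chain p T) → p ≤ j → j ≤ T → 2 ≤ j → Chain.link c j < t → ¬ Taken t (j ∸ 1) → ⊥
    Chain-earlyLink⇒⊥ {p} {T} {suc w} {t} c p≤1+w 1+w≤T (s≤s 1≤w) early ¬Taken-w = ¬TakenT headTakesT
      where
      open Chain c
      p≤T = ≤-trans p≤1+w 1+w≤T
      inChain : ∀ d → p ≤ d + suc w
      inChain d = ≤-trans p≤1+w (m≤n+m (suc w) d)
      stillFree : ∀ d → d + suc w ≤ T → ¬ Taken (link (d + suc w)) (d + suc w)
      stillFree zero    bound = fallbackFreeLater⇒preferenceFree
        (link<n p≤1+w bound) (A-link p≤1+w bound) (R-link p≤1+w bound) 1≤w early ¬Taken-w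
      stillFree (suc d) bound = fallbackFreeLater⇒preferenceFree
        (link<n (inChain (suc d)) bound) (A-link (inChain (suc d)) bound) (R-link (inChain (suc d)) bound)
        (≤-trans 1≤w (≤-trans (n≤1+n w) (m≤n+m (suc w) d)))
        (link-decreasing (inChain d) (n<1+n _) bound) (stillFree d (<⇒≤ bound))
      ¬TakenT : ¬ Taken (link T) T
      ¬TakenT = subst (λ y → ¬ Taken (link y) y) (m∸n+n≡m 1+w≤T) (stillFree (T ∸ suc w) (≤-reflexive (m∸n+n≡m 1+w≤T)))
      headTakesT : Taken (link T) T
      headTakesT = head , head<link p≤T ≤-refl ,
        trans (spot-atPreference (<-trans (head<link p≤T ≤-refl) (link<n p≤T ≤-refl))
                (¬TakenT ∘ Taken-mono (<⇒≤ (head<link p≤T ≤-refl)) ∘ subst (Taken head) A-head))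
              (cong just A-head)

    parkedAbove⇒prefersAbove : ∀ {j t i s} → 1 ≤ j → ¬ Taken t (j ∸ 1) → i < t → i < n → spot i ≡ just s → j ≤ s → j ≤ A i
    parkedAbove⇒prefersAbove {j} {i = i} 1≤j ¬Taken-j-1 i<t i<n si j≤s with parkedVia i<n si
    ... | atPreference s≡a     = subst (j ≤_) s≡a j≤s
    ... | backward s≡a-1 _ _ _ = ≤-trans j≤s (subst (_≤ A i) (sym s≡a-1) (m∸n≤m (A i) 1))
    ... | forward a<s blocked with j ≤? A i
    ...   | yes j≤a = j≤a
    ...   | no  j≰a = contradiction
      (Taken-mono (<⇒≤ i<t) (blocked (j ∸ 1) (∸-monoˡ-≤ 1 (≰⇒> j≰a)) (<-≤-trans (m∸1<m 1≤j) j≤s))) ¬Taken-j-1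

    stuck⇒jam : ∀ {t} → t < n → spot t ≡ nothing →
      ∃ λ j → j ≤ A t × (∀ y → j ≤ y → y ≤ n → Taken t y) × ¬ Taken t (j ∸ 1)
    stuck⇒jam {t} t<n fails with runDown (Taken? t) (A t) (stuck t<n fails (A t) ≤-refl (proj₂ (valid t<n)))
    ... | j , (j≤a , takenBelow) , inj₁ refl = contradiction (takenBelow 0 z≤n z≤n) ¬Taken-0
    ... | j , (j≤a , takenBelow) , inj₂ ¬Taken-j-1 = j , j≤a , taken , ¬Taken-j-1
      where
      taken : ∀ y → j ≤ y → y ≤ n → Taken t y
      taken y j≤y y≤n with y ≤? A t
      ... | yes y≤a = takenBelow y j≤y y≤a
      ... | no  y≰a = stuck t<n fails y (<⇒≤ (≰⇒> y≰a)) y≤n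

    module FailingCar (chains : MaximalChains) {t j} (t<n : t < n) (fails : spot t ≡ nothing) (j≤At : j ≤ A t)
                      (taken : ∀ y → j ≤ y → y ≤ n → Taken t y) (¬Taken-j-1 : ¬ Taken t (j ∸ 1)) where

      j≤n : j ≤ n
      j≤n = ≤-trans j≤At (proj₂ (valid t<n))

      1≤j : 1 ≤ j
      1≤j with taken j ≤-refl j≤n
      ... | _ , _ , si = proj₁ (spot-inRange si)

      earlyCars : List ℕ
      earlyCars = prefAtLeast j t

      earlyCars-many : suc (n ∸ j) ≤ length earlyCars
      earlyCars-many = spotsTaken⇒prefAtLeast j≤n taken λ i<t → parkedAbove⇒prefersAbove 1≤j ¬Taken-j-1 i<t (<-trans i<t t<n)

      earlyCars-members : ∀ {i} → i ∈ earlyCars → i < n × j ≤ A i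
      earlyCars-members i∈ with ∈-prefAtLeast⁻ i∈
      ... | i<t , j≤Ai = <-trans i<t t<n , j≤Ai

      crowded : Crowded j
      crowded = (1≤j , j≤n) , ≤-trans (s≤s earlyCars-many)
        (length≤countGe-prefs (Unique-∷-above (proj₁ ∘ ∈-prefAtLeast⁻) (Unique-prefAtLeast j t)) members)
        where
        members : ∀ {i} → i ∈ t ∷ earlyCars → i < n × j ≤ A i
        members (here refl) = t<n , j≤At
        members (there i∈)  = earlyCars-members i∈

      chain⇒⊥ : ∀ {p q T} → IsMaximalInterval Crowded p q → p ≤ j → j ≤ T → 2 ≤ j → Chain p T → ⊥
      chain⇒⊥ {p} maximal p≤j j≤T 2≤j c with <-cmp (Chain.link c j) t
      ... | tri< b<t _ _ = Chain-earlyLink⇒⊥ c p≤j j≤T 2≤j b<t ¬Taken-j-1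
      ... | tri≈ _ refl _ = contradiction
        (trans (sym fails) (spot-backward t<n (A-link p≤j j≤T) (R-link p≤j j≤T) 2≤j (taken j ≤-refl j≤n) ¬Taken-j-1)) λ ()
        where open Chain c
      ... | tri> _ _ t<b = maximal⇒¬overcrowded maximal (begin
        3 + (n ∸ p)                            ≡⟨ cong (3 +_) (∸-split p≤j j≤n) ⟨
        3 + ((j ∸ p) + (n ∸ j))                ≡⟨ +-assoc 3 (j ∸ p) (n ∸ j) ⟨
        (3 + (j ∸ p)) + (n ∸ j)                ≡⟨ cong (_+ (n ∸ j)) (+-comm 3 (j ∸ p)) ⟩
        ((j ∸ p) + 3) + (n ∸ j)                ≡⟨ +-assoc (j ∸ p) 3 (n ∸ j) ⟩
        (j ∸ p) + (3 + (n ∸ j))                ≤⟨ +-monoʳ-≤ (j ∸ p) (≤-trans (s≤s (s≤s earlyCars-many)) (length≤countGe-prefs unique members)) ⟩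
        (j ∸ p) + countGe j prefs              ≡⟨ cong (λ k → (j ∸ p) + countGe k prefs) (m+[n∸m]≡n p≤j) ⟨
        (j ∸ p) + countGe (p + (j ∸ p)) prefs  ≤⟨ countGe-shift (j ∸ p) p prefs linksBelow ⟩
        countGe p prefs                        ∎)
        where
        open ≤-Reasoning
        open Chain c
        unique : Unique (link j ∷ t ∷ earlyCars)
        unique = Unique-∷-above (λ { (here refl) → t<b ; (there i∈) → <-trans (proj₁ (∈-prefAtLeast⁻ i∈)) t<b })
                   (Unique-∷-above (proj₁ ∘ ∈-prefAtLeast⁻) (Unique-prefAtLeast j t))
        members : ∀ {i} → i ∈ link j ∷ t ∷ earlyCars → i < n × j ≤ A i
        members (here refl)         = link<n p≤j j≤T , ≤-reflexive (sym (A-link p≤j j≤T))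
        members (there (here refl)) = t<n , j≤At
        members (there (there i∈)) = earlyCars-members i∈
        linksBelow : ∀ w → p ≤ w → w < p + (j ∸ p) → w ∈ prefs
        linksBelow w p≤w w< with ≤-trans (<⇒≤ (subst (w <_) (m+[n∸m]≡n p≤j) w<)) j≤T
        ... | w≤T = subst (_∈ prefs) (A-link p≤w w≤T) (∈-applyUpTo⁺ A (link<n p≤w w≤T))

      absurd : ⊥
      absurd with j ≟ 1 | maximalIntervalAround Crowded? Crowded⇒≤n crowded
      ... | yes refl | _ = ¬Crowded-1 crowded
      ... | no  j≢1  | p , q , p≤j , j≤q , maximal with chains p q maximal
      ...   | T , q≤T , c = chain⇒⊥ maximal p≤j (≤-trans j≤q q≤T) (≤∧≢⇒< 1≤j (j≢1 ∘ sym)) c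

    allPark : MaximalChains → AllPark
    allPark chains t t<n with spot t in st
    ... | just s  = s , refl
    ... | nothing with stuck⇒jam t<n st
    ...   | j , j≤At , taken , ¬Taken-j-1 = ⊥-elim (FailingCar.absurd chains t<n st j≤At taken ¬Taken-j-1)

module Instance {n : ℕ} (α : Vec ℕ n) (ρ : Vec Bool n) where

  A : ℕ → ℕ
  A = at 0 (toList α)

  R : ℕ → Bool
  R = at false (toList ρ)

  open Parking n A R public

  lookup-α : ∀ {i} (i<n : i < n) → lookup α (fromℕ< i<n) ≡ A i
  lookup-α i<n = trans (lookup≡at 0 α (fromℕ< i<n)) (cong A (toℕ-fromℕ< i<n))

  lookup-ρ : ∀ {i} (i<n : i < n) → lookup ρ (fromℕ< i<n) ≡ R i
  lookup-ρ i<n = trans (lookup≡at false ρ (fromℕ< i<n)) (cong R (toℕ-fromℕ< i<n))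

  prefs≡α : prefs ≡ toList α
  prefs≡α = subst (λ m → applyUpTo A m ≡ toList α) (length-toList α) (applyUpTo-at 0 (toList α))

  Witness : ℕ → ℕ → Set
  Witness p q = ∃[ k ] (q ∸ p + 2 ≤ suc (suc k) ×
    Σ (Fin (suc (suc k)) → Fin n) λ js → (((x y : Fin (suc (suc k))) → x F.< y → js x F.< js y) ×
      (lookup α (js zero) ≡ lookup α (js (suc zero))) ×
      ((i : Fin (suc k)) →
        (lookup α (js (suc i)) ≡ suc (suc k) ∸ suc (toℕ (suc i)) + p) ×
        (lookup ρ (js (suc i)) ≡ true))))

  -- The witness lists the head of the chain followed by the links for T, T - 1, ..., p.
  Chain⇒Witness : ∀ {p q T} → p ≤ T → q ≤ T → Chain p T → Witness p q
  Chain⇒Witness {p} {q} {T} p≤T q≤T c = k , bound , js , increasing , sameStart , descending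
    where
    open Chain c
    k = T ∸ p
    w : Fin (suc k) → ℕ
    w i = k ∸ toℕ i + p
    p≤w : ∀ i → p ≤ w i
    p≤w i = m≤n+m p (k ∸ toℕ i)
    w≤T : ∀ i → w i ≤ T
    w≤T i = subst (w i ≤_) (m∸n+n≡m p≤T) (+-monoˡ-≤ p (m∸n≤m k (toℕ i)))
    head<n : head < n
    head<n = <-trans (head<link p≤T ≤-refl) (link<n p≤T ≤-refl)
    js : Fin (suc (suc k)) → Fin n
    js zero    = fromℕ< head<n
    js (suc i) = fromℕ< (link<n (p≤w i) (w≤T i))
    bound : q ∸ p + 2 ≤ suc (suc k)
    bound = subst (_≤ suc (suc k)) (+-comm 2 (q ∸ p)) (s≤s (s≤s (∸-monoˡ-≤ p q≤T)))
    descending : (i : Fin (suc k)) → (lookup α (js (suc i)) ≡ w i) × (lookup ρ (js (suc i)) ≡ true)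
    descending i = trans (lookup-α (link<n (p≤w i) (w≤T i))) (A-link (p≤w i) (w≤T i)) ,
                   trans (lookup-ρ (link<n (p≤w i) (w≤T i))) (R-link (p≤w i) (w≤T i))
    sameStart : lookup α (js zero) ≡ lookup α (js (suc zero))
    sameStart = trans (lookup-α head<n) (trans A-head (sym (trans (proj₁ (descending zero)) (m∸n+n≡m p≤T))))
    increasing : (x y : Fin (suc (suc k))) → x F.< y → js x F.< js y
    increasing zero    (suc j) _ =
      subst₂ _<_ (sym (toℕ-fromℕ< head<n)) (sym (toℕ-fromℕ< _)) (head<link (p≤w j) (w≤T j))
    increasing (suc i) (suc j) (s≤s i<j) =
      subst₂ _<_ (sym (toℕ-fromℕ< _)) (sym (toℕ-fromℕ< _))
        (link-decreasing (p≤w j) (+-monoˡ-< p (∸-monoʳ-< i<j (≤-pred (toℕ<n j)))) (w≤T i))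

  Witness⇒Chain : ∀ {p q} → Witness p q → ∃ λ T → q ≤ T × Chain p T
  Witness⇒Chain {p} {q} (k , bound , js , increasing , sameStart , descending) = k + p , q≤T , chain
    where
    q≤T : q ≤ k + p
    q≤T = ≤-trans (m≤n+m∸n q p) (subst (p + (q ∸ p) ≤_) (+-comm p k)
            (+-monoʳ-≤ p (≤-pred (≤-pred (subst (_≤ suc (suc k)) (+-comm (q ∸ p) 2) bound)))))
    index : ℕ → Fin (suc k)
    index w = fromℕ< (s≤s (m∸n≤m k (w ∸ p)))
    toℕ-index : ∀ w → toℕ (index w) ≡ k ∸ (w ∸ p)
    toℕ-index w = toℕ-fromℕ< (s≤s (m∸n≤m k (w ∸ p)))
    w-p≤k : ∀ {w} → w ≤ k + p → w ∸ p ≤ k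
    w-p≤k {w} w≤T = subst (w ∸ p ≤_) (m+n∸n≡m k p) (∸-monoˡ-≤ p w≤T)
    link : ℕ → ℕ
    link w = toℕ (js (suc (index w)))
    A-link : ∀ {w} → p ≤ w → w ≤ k + p → A (link w) ≡ w
    A-link {w} p≤w w≤T = begin
      A (link w)                     ≡⟨ lookup≡at 0 α _ ⟨
      lookup α (js (suc (index w)))  ≡⟨ proj₁ (descending (index w)) ⟩
      k ∸ toℕ (index w) + p          ≡⟨ cong (λ i → k ∸ i + p) (toℕ-index w) ⟩
      k ∸ (k ∸ (w ∸ p)) + p          ≡⟨ cong (_+ p) (m∸[m∸n]≡n (w-p≤k w≤T)) ⟩
      w ∸ p + p                      ≡⟨ m∸n+n≡m p≤w ⟩
      w                              ∎
      where open ≡-Reasoning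
    chain : Chain p (k + p)
    chain = record
      { head = toℕ (js zero)
      ; link = link
      ; A-head = trans (sym (lookup≡at 0 α _)) (trans sameStart (proj₁ (descending zero)))
      ; head<link = λ {w} _ _ → increasing zero (suc (index w)) (s≤s z≤n)
      ; link<n = λ _ _ → toℕ<n _
      ; A-link = A-link
      ; R-link = λ {w} _ _ → trans (sym (lookup≡at false ρ _)) (proj₂ (descending (index w)))
      ; link-decreasing = λ {w} {w′} p≤w w<w′ w′≤T → increasing (suc (index w′)) (suc (index w))
          (s≤s (subst₂ _<_ (sym (toℕ-index w′)) (sym (toℕ-index w)) (∸-monoʳ-< (∸-monoˡ-< w<w′ p≤w) (w-p≤k w′≤T))))
      }

  InPR⇒AllPark : InPR n α ρ → AllPark
  InPR⇒AllPark inPR t t<n =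
    subst (λ i → ∃ λ s → spot i ≡ just s) (+-identityʳ t)
      (runCars⇒ParkedFrom 0 (toList α) (toList ρ) (λ i → cong A (sym (+-identityʳ i))) (λ i → cong R (sym (+-identityʳ i)))
        inPR t (subst (t <_) (sym (length-toList α)) t<n))

  AllPark⇒InPR : AllPark → InPR n α ρ
  AllPark⇒InPR allParked =
    ParkedFrom⇒runCars 0 (toList α) (toList ρ) (λ i → cong A (sym (+-identityʳ i))) (λ i → cong R (sym (+-identityʳ i)))
      (trans (length-toList α) (sym (length-toList ρ)))
      λ d d< → subst (λ i → ∃ λ s → spot i ≡ just s) (sym (+-identityʳ d)) (allParked d (subst (d <_) (length-toList α) d<))

  module _ (pp : InPP n α) where

    valid : ∀ {i} → i < n → 1 ≤ A i × A i ≤ n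
    valid i<n = subst (λ a → 1 ≤ a × a ≤ n) (lookup-α i<n) (pp (fromℕ< i<n))

    InU⇔Crowded : ∀ j → InU n α j ⇔ Crowded j
    InU⇔Crowded j = mk⇔
      (λ (inStreet , u≥1) → inStreet , subst₂ _<_ (+-comm (n ∸ j) 1) S≡ (Equivalence.to (1≤m-n⇔n<m S (n ∸ j + 1)) u≥1))
      (λ (inStreet , crowded) → inStreet ,
        Equivalence.from (1≤m-n⇔n<m S (n ∸ j + 1)) (subst₂ _<_ (+-comm 1 (n ∸ j)) (sym S≡) crowded))
      where
      S = sum (map (count α) (range j n))
      α<1+n : ∀ {x} → x ∈ toList α → x < j + (suc n ∸ j)
      α<1+n x∈ with ∈-applyUpTo⁻ A (subst (_ ∈_) (sym prefs≡α) x∈)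
      ... | i , i<n , refl = <-≤-trans (s≤s (proj₂ (valid i<n))) (m≤n+m∸n (suc n) j)
      S≡ : S ≡ countGe j prefs
      S≡ = begin
        sum (map (count α) (range j n))                          ≡⟨ cong (λ js → sum (map (count α) js)) (range≡interval j n) ⟩
        sum (map (countEq (toList α)) (interval j (suc n ∸ j)))  ≡⟨ sum-countEq j (suc n ∸ j) (toList α) α<1+n ⟩
        countGe j (toList α)                                     ≡⟨ cong (countGe j) prefs≡α ⟨
        countGe j prefs                                          ∎
        where open ≡-Reasoning

mainTheorem18 : (n : ℕ) (α : Vec ℕ n) (ρ : Vec Bool n) → InPP n α →
    InPR n α ρ ⇔
      ((p q : ℕ) → IsMaximalInterval (InU n α) p q →
        ∃[ k ] (q ∸ p + 2 ≤ suc (suc k) ×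
          Σ (Fin (suc (suc k)) → Fin n) λ js → (((x y : Fin (suc (suc k))) → x F.< y → js x F.< js y) ×
            (lookup α (js zero) ≡ lookup α (js (suc zero))) ×
            ((i : Fin (suc k)) →
              (lookup α (js (suc i)) ≡ suc (suc k) ∸ suc (toℕ (suc i)) + p) ×
              (lookup ρ (js (suc i)) ≡ true)))))
mainTheorem18 n α ρ pp = mk⇔
  (λ inPR p q maximal →
    let T , q≤T , c = onlyIf (valid pp) (InPR⇒AllPark inPR) (IsIntervalIn-map (Equivalence.to (InU⇔Crowded pp _)) (proj₁ maximal))
    in Chain⇒Witness (≤-trans (proj₁ (proj₁ maximal)) q≤T) q≤T c)
  (λ witnesses → AllPark⇒InPR (allPark (valid pp) λ p q maximal →
    Witness⇒Chain (witnesses p q (IsMaximalInterval-⇔ (⇔.sym ∘ InU⇔Crowded pp) maximal))))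
  where open Instance α ρ
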